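{- Let $(\mathscr{L},W)$ be a logical structure such that $W$ satisfies cautious monotonicity. Let $\mathsf{S}=(\mathbf{B},R_{cm},\models,\mathcal{P}(\mathscr{L}))$ be the normal $S$-semantics for $\mathscr{L}$ with $\mathbf{B}=\{\chi_\Gamma:\Gamma\subseteq\mathscr{L}\}\cup\{\chi_{W(\Gamma)}:\Gamma\subseteq\mathscr{L}\}$ and $R_{cm}=\bigcup_{\Gamma\subseteq\mathscr{L}}R_\Gamma$, where for each $\Gamma\subseteq\mathscr{L}$, $R_\Gamma$ is the set of pairs $(\chi_\Sigma,\chi_{W(\Sigma)})$ with $\Sigma\subseteq\mathscr{L}$ such that $\Sigma=\Gamma$ or $\Sigma\subseteq W(\Gamma)$. Then $W=W^{\mathsf{S}}_{II}$.
   Context: A logical structure is a pair $(\mathscr{L},W)$ with $\mathscr{L}$ a set and $W:\mathcal{P}(\mathscr{L})\to\mathcal{P}(\mathscr{L})$. $W$ satisfies cautious monotonicity if for all $\Gamma,\Sigma\subseteq\mathscr{L}$, $\Gamma\subseteq\Sigma\subseteq W(\Gamma)$ implies $W(\Gamma)\subseteq W(\Sigma)$. For $\Gamma\subseteq\mathscr{L}$, $\chi_\Gamma:\mathscr{L}\to\{0,1\}$ is its characteristic function. An $S$-semantics for $\mathscr{L}$ is a tuple $(\mathbf{B},R,\models,\mathcal{P}(\mathscr{L}))$ with $\mathbf{B}\subseteq\{0,1\}^{\mathscr{L}}$, $R\subseteq\mathbf{B}\times\mathbf{B}$, $\models\subseteq\mathbf{B}\times\mathcal{P}(\mathscr{L})$;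 it is normal if for all $v\in\mathbf{B}$, $\Gamma\subseteq\mathscr{L}$: $v\models\Gamma$ iff $v(\Gamma)\subseteq\{1\}$. Given the logical structure $(\mathscr{L},W)$, the type-II consequence operator $W^{\mathsf{S}}_{II}$ is defined by: $\alpha\in W^{\mathsf{S}}_{II}(\Gamma)$ iff there exists $U\subseteq R$ with $(\chi_\Gamma,\chi_{W(\Gamma)})\in U$ such that for all $(v,w)\in U$, $v\models\Gamma$ implies $w\models\{\alpha\}$. -}

module Defs where

open import Data.Bool using (Bool; true; false)
open import Data.Product using (Σ; Σ-syntax; ∃; ∃-syntax; _×_; _,_)
open import Data.Sum using (_⊎_)
open import Relation.Binary.PropositionalEquality using (_≡_)
open import Function.Bundles using (_⇔_)

-- Subsets of 𝓛 are represented by their characteristic functions 𝓛 → {0,1},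
-- with {0,1} = Bool (false = 0, true = 1). Hence χ_Γ is Γ itself.
Sub : Set → Set
Sub 𝓛 = 𝓛 → Bool

χ : {𝓛 : Set} → Sub 𝓛 → (𝓛 → Bool)
χ Γ = Γ

_∈ˢ_ : {𝓛 : Set} → 𝓛 → Sub 𝓛 → Set
x ∈ˢ Γ = Γ x ≡ true

_⊆ˢ_ : {𝓛 : Set} → Sub 𝓛 → Sub 𝓛 → Set
Γ ⊆ˢ Σ' = ∀ x → x ∈ˢ Γ → x ∈ˢ Σ'

-- singleton {α} (needs decidable equality on 𝓛 to build as a Bool function;
-- we avoid it: w ⊨ {α} unfolds to w α = 1, see ⊨single below)

record LogicalStructure : Set₁ where
  field
    𝓛 : Set
    W : Sub 𝓛 → Sub 𝓛

CautiousMonotonicity : {𝓛 : Set} → (Sub 𝓛 → Sub 𝓛) → Set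
CautiousMonotonicity {𝓛} W =
  (Γ Σ' : Sub 𝓛) → Γ ⊆ˢ Σ' → Σ' ⊆ˢ W Γ → W Γ ⊆ˢ W Σ'

_⊨_ : {𝓛 : Set} → (𝓛 → Bool) → Sub 𝓛 → Set
v ⊨ Γ = ∀ x → x ∈ˢ Γ → v x ≡ true

_⊨single_ : {𝓛 : Set} → (𝓛 → Bool) → 𝓛 → Set
v ⊨single α = v α ≡ true

record NormalSSemantics (𝓛 : Set) : Set₁ where
  field
    𝐁 : (𝓛 → Bool) → Set
    R : (𝓛 → Bool) → (𝓛 → Bool) → Set
    R⊆B×B : ∀ v w → R v w → 𝐁 v × 𝐁 w

W-II : {𝓛 : Set} → (Sub 𝓛 → Sub 𝓛) → NormalSSemantics 𝓛 → Sub 𝓛 → 𝓛 → Set₁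
W-II {𝓛} W S Γ α =
  Σ[ U ∈ ((𝓛 → Bool) → (𝓛 → Bool) → Set) ]
    ((∀ v w → U v w → NormalSSemantics.R S v w)
    × U (χ Γ) (χ (W Γ))
    × (∀ v w → U v w → v ⊨ Γ → w ⊨single α))

B-cm : {𝓛 : Set} → (Sub 𝓛 → Sub 𝓛) → (𝓛 → Bool) → Set
B-cm {𝓛} W v = Σ[ Γ ∈ Sub 𝓛 ] (v ≡ χ Γ ⊎ v ≡ χ (W Γ))

R-Γ : {𝓛 : Set} → (Sub 𝓛 → Sub 𝓛) → Sub 𝓛 → (𝓛 → Bool) → (𝓛 → Bool) → Set
R-Γ {𝓛} W Γ v w =
  Σ[ Σ' ∈ Sub 𝓛 ] ((Σ' ≡ Γ ⊎ Σ' ⊆ˢ W Γ) × v ≡ χ Σ' × w ≡ χ (W Σ'))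

R-cm : {𝓛 : Set} → (Sub 𝓛 → Sub 𝓛) → (𝓛 → Bool) → (𝓛 → Bool) → Set
R-cm {𝓛} W v w = Σ[ Γ ∈ Sub 𝓛 ] R-Γ W Γ v w

R-cm⊆B×B : {𝓛 : Set} (W : Sub 𝓛 → Sub 𝓛) → ∀ v w → R-cm W v w → B-cm W v × B-cm W w
R-cm⊆B×B W v w (Γ , Σ' , _ , v≡ , w≡) = (Σ' , _⊎_.inj₁ v≡) , (Σ' , _⊎_.inj₂ w≡)

S-cm : {𝓛 : Set} → (Sub 𝓛 → Sub 𝓛) → NormalSSemantics 𝓛
S-cm W = record { 𝐁 = B-cm W ; R = R-cm W ; R⊆B×B = R-cm⊆B×B W }

module Submission where

open import Defs
open import Relation.Binary.PropositionalEquality using (refl)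
open import Function.Bundles using (_⇔_; mk⇔)
open import Data.Product using (_,_)
open import Data.Sum using (inj₁; inj₂)

-- The pair (χ Γ, χ (W Γ)) is always in U and χ Γ ⊨ Γ, so every α in
-- W-II Γ is forced into W Γ.  Conversely the witness U = R_Γ works: its pairs
-- are (χ Γ, χ (W Γ)) itself and (χ Σ, χ (W Σ)) with Σ ⊆ W Γ, where χ Σ ⊨ Γ
-- means Γ ⊆ Σ, and cautious monotonicity gives W Γ ⊆ W Σ.

χ⊨ : {𝓛 : Set} (Γ : Sub 𝓛) → χ Γ ⊨ Γ
χ⊨ Γ x x∈Γ = x∈Γ

W-II⊆W : {𝓛 : Set} (W : Sub 𝓛 → Sub 𝓛) (S : NormalSSemantics 𝓛)
  (Γ : Sub 𝓛) (α : 𝓛) → W-II W S Γ α → α ∈ˢ W Γ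
W-II⊆W W S Γ α (U , U⊆R , ΓWΓ∈U , sound) = sound (χ Γ) (χ (W Γ)) ΓWΓ∈U (χ⊨ Γ)

R-Γ-sound : {𝓛 : Set} (W : Sub 𝓛 → Sub 𝓛) → CautiousMonotonicity W →
  (Γ : Sub 𝓛) (α : 𝓛) → α ∈ˢ W Γ →
  ∀ v w → R-Γ W Γ v w → v ⊨ Γ → w ⊨single α
R-Γ-sound W cm Γ α α∈WΓ v w (Σ' , inj₁ refl , refl , refl) _    = α∈WΓ
R-Γ-sound W cm Γ α α∈WΓ v w (Σ' , inj₂ Σ'⊆WΓ , refl , refl) Γ⊆Σ' =
  cm Γ Σ' Γ⊆Σ' Σ'⊆WΓ α α∈WΓ

W⊆W-II : {𝓛 : Set} (W : Sub 𝓛 → Sub 𝓛) → CautiousMonotonicity W →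
  (Γ : Sub 𝓛) (α : 𝓛) → α ∈ˢ W Γ → W-II W (S-cm W) Γ α
W⊆W-II W cm Γ α α∈WΓ =
  R-Γ W Γ , (λ v w r → Γ , r) , (Γ , inj₁ refl , refl , refl) ,
  R-Γ-sound W cm Γ α α∈WΓ

mainTheorem4 : (L : LogicalStructure)
    → CautiousMonotonicity (LogicalStructure.W L)
    → (Γ : Sub (LogicalStructure.𝓛 L)) (α : LogicalStructure.𝓛 L)
    → (α ∈ˢ LogicalStructure.W L Γ) ⇔ W-II (LogicalStructure.W L) (S-cm (LogicalStructure.W L)) Γ α
mainTheorem4 L cm Γ α =
  mk⇔ (W⊆W-II W cm Γ α) (W-II⊆W W (S-cm W) Γ α)
  where open LogicalStructure L
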